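{- Let $N,\ell$ be positive integers and let $\mathcal F\subseteq\{ -1,+1\}^N$ be a family of binary sequences. Let $F_N=\{f_1,\dots,f_N\}$, $G_N=\{g_1,\dots,g_N\}$, $H_N=\{h_1,\dots,h_N\}$ be three distinct sequences in $\mathcal F$, and define $E_N=\{e_1,\dots,e_N\}\in\{ -1,+1\}^N$ by $e_n=f_n$ if $h_n=1$ and $e_n=g_n$ if $h_n=-1$. Then \[ C_{\ell}(E_N)\le 2^{\ell}\max_{\ell\le m\le 2\ell}\Phi_m(\mathcal F). \]
   Context: For $E_N=\{e_1,\dots,e_N\}\in\{ -1,+1\}^N$, the correlation measure of order $\ell$ is $C_{\ell}(E_N)=\max_{M,D}\left|\sum_{n=1}^{M}e_{n+d_1}\cdots e_{n+d_\ell}\right|$, the maximum over all $M\in\mathbb N$ and $D=(d_1,\dots,d_\ell)$ of integers with $0\le d_1<\dots<d_\ell<M+d_\ell\le N$. Cross-correlation measure: for binary sequences $E^{(1)},\dots,E^{(m)}\in\{ -1,+1\}^N$, $E^{(i)}=(e^{(i)}_1,\dots,e^{(i)}_N)$, $M\in\mathbb N$ and $D=(d_1,\dots,d_m)$ non-negative integers with $0\le d_1\le\dots\le d_m<M+d_m\le N$, put $V_m(E^{(1)},\dots,E^{(m)},M,D)=\sum_{n=1}^{M}e^{(1)}_{n+d_1}\cdots e^{(m)}_{n+d_m}$, and let $\tilde C_m(E^{(1)},\dots,E^{(m)})=\max_{M,D}|V_m(E^{(1)},\dots,E^{(m)},M,D)|$, the maximum over such $M,D$ with the extra restriction that if $E^{(i)}=E^{(j)}$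 for some $i\ne j$ then $d_i\ne d_j$. The cross-correlation measure of order $m$ of $\mathcal F$ is $\Phi_m(\mathcal F)=\max\tilde C_m(E^{(1)},\dots,E^{(m)})$ over all $m$-tuples with $E^{(i)}\in\mathcal F$ for all $i$. -}

module Defs where

open import Data.Bool using (Bool; true; false; _∧_; not; if_then_else_)
open import Data.Nat as ℕ using (ℕ; zero; suc; _+_; _≤_; _<_; _⊔_; _<?_; _≤?_; _≟_)
open import Data.Integer as ℤ using (ℤ; ∣_∣; 0ℤ; 1ℤ; -1ℤ)
open import Data.Sign using (Sign)
import Data.Sign.Properties as SignP
open import Data.Fin using (Fin; fromℕ<)
open import Data.Vec as Vec using (Vec; []; _∷_; lookup; zipWith; toList)
import Data.Vec.Properties as VecP
open import Data.List as List using (List; []; _∷_; map; upTo; concatMap; filter; foldr)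
open import Data.Bool.Properties using (T?)
open import Relation.Binary.PropositionalEquality using (_≡_; _≢_)
open import Data.Product using (_×_; _,_; proj₁; proj₂)
open import Relation.Nullary.Decidable using (⌊_⌋; Dec; yes; no)

Seq : ℕ → Set
Seq N = Vec Sign N

val : Sign → ℤ
val Sign.+ = 1ℤ
val Sign.- = -1ℤ

-- 1-based access e_k (k = 1..N); out of range gives 0 (never used for admissible data)
at : {N : ℕ} → Seq N → ℕ → ℤ
at {N} e zero = 0ℤ
at {N} e (suc j) with j <? N
... | yes p = val (lookup e (fromℕ< p))
... | no _  = 0ℤ

sumℤ : List ℤ → ℤ
sumℤ = foldr ℤ._+_ 0ℤ

prodℤ : List ℤ → ℤ
prodℤ = foldr ℤ._*_ 1ℤ

maxList : List ℕ → ℕ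
maxList = foldr _⊔_ 0

vecs : (n k : ℕ) → List (Vec ℕ k)
vecs n zero    = [] ∷ []
vecs n (suc k) = concatMap (λ d → map (d ∷_) (vecs n k)) (upTo n)

tuples : {A : Set} → List A → (k : ℕ) → List (Vec A k)
tuples xs zero    = [] ∷ []
tuples xs (suc k) = concatMap (λ x → map (x ∷_) (tuples xs k)) xs

allB : {A : Set} → (A → Bool) → List A → Bool
allB p []       = true
allB p (x ∷ xs) = p x ∧ allB p xs

strictInc : List ℕ → Bool
strictInc []            = true
strictInc (x ∷ [])      = true
strictInc (x ∷ y ∷ ys)  = ⌊ x <? y ⌋ ∧ strictInc (y ∷ ys)

nonDec : List ℕ → Bool
nonDec []            = true
nonDec (x ∷ [])      = true
nonDec (x ∷ y ∷ ys)  = ⌊ x ≤? y ⌋ ∧ nonDec (y ∷ ys)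

-- d_last < M + d_last ≤ N, expressed as M ≥ 1 and M + d_i ≤ N for all i
-- (equivalent given the ordering of D)
fits : (N M : ℕ) → List ℕ → Bool
fits N M ds = ⌊ 1 ≤? M ⌋ ∧ allB (λ d → ⌊ M + d ≤? N ⌋) ds

corrSum : {N ℓ : ℕ} → Seq N → ℕ → Vec ℕ ℓ → ℤ
corrSum e M D =
  sumℤ (map (λ n → prodℤ (map (λ d → at e (suc n + d)) (toList D))) (upTo M))

corrAdm : (N : ℕ) {ℓ : ℕ} → ℕ → Vec ℕ ℓ → Bool
corrAdm N M D = strictInc (toList D) ∧ fits N M (toList D)

-- C_ℓ(E_N) = max_{M,D} |Σ ...|  (maximum over the finite admissible set; 0 if empty)
C : {N : ℕ} (ℓ : ℕ) → Seq N → ℕ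
C {N} ℓ e =
  maxList (concatMap
    (λ M → map (λ D → ∣ corrSum e M D ∣)
                (filter (λ D → T? (corrAdm N M D)) (vecs N ℓ)))
    (upTo (suc N)))

seq? : {N : ℕ} (x y : Seq N) → Dec (x ≡ y)
seq? = VecP.≡-dec SignP._≟_

distinctShifts : {N : ℕ} → List (Seq N × ℕ) → Bool
distinctShifts []             = true
distinctShifts ((E , d) ∷ rest) =
  allB (λ p → not (⌊ seq? E (proj₁ p) ⌋ ∧ ⌊ d ≟ proj₂ p ⌋)) rest ∧ distinctShifts rest

crossSum : {N m : ℕ} → Vec (Seq N) m → ℕ → Vec ℕ m → ℤ
crossSum Es M D =
  sumℤ (map (λ n → prodℤ (toList (zipWith (λ E d → at E (suc n + d)) Es D))) (upTo M))

crossAdm : (N : ℕ) {m : ℕ} → Vec (Seq N) m → ℕ → Vec ℕ m → Bool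
crossAdm N Es M D =
  nonDec (toList D) ∧ fits N M (toList D) ∧ distinctShifts (toList (zipWith _,_ Es D))

Ctilde : {N m : ℕ} → Vec (Seq N) m → ℕ
Ctilde {N} {m} Es =
  maxList (concatMap
    (λ M → map (λ D → ∣ crossSum Es M D ∣)
                (filter (λ D → T? (crossAdm N Es M D)) (vecs N m)))
    (upTo (suc N)))

Φ : {N : ℕ} (m : ℕ) → List (Seq N) → ℕ
Φ m 𝓕 = maxList (map Ctilde (tuples 𝓕 m))

maxΦ : {N : ℕ} (ℓ : ℕ) → List (Seq N) → ℕ
maxΦ ℓ 𝓕 = maxList (map (λ j → Φ (ℓ + j) 𝓕) (upTo (suc ℓ)))

mix : {N : ℕ} → Seq N → Seq N → Seq N → Seq N
mix f g h = zipWith (λ fg hn → choose hn fg) (zipWith _,_ f g) h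
  where
    choose : Sign → Sign × Sign → Sign
    choose Sign.+ (a , b) = a
    choose Sign.- (a , b) = b

-- Since 2 e_n = f_n (1 + h_n) + g_n (1 − h_n), multiplying out 2^ℓ e_{n+d_1} ⋯ e_{n+d_ℓ}
-- gives 4^ℓ signed products of between ℓ and 2ℓ factors f_{n+d}, g_{n+d}, h_{n+d}.
-- Summed over n, each product is a cross-correlation sum of order ℓ ≤ m ≤ 2ℓ, and it is
-- admissible: the shifts d_1 < ⋯ < d_ℓ are distinct, and a repeated shift only occurs in
-- the pairs (f, d), (h, d) or (g, d), (h, d), where the sequences differ. Hence
-- 2^ℓ |Σ_n e_{n+d_1} ⋯ e_{n+d_ℓ}| ≤ 4^ℓ max_m Φ_m(𝓕).
module Submission where

open import Defs
import Algebra.Properties.CommutativeSemigroup as CommSemigroupProperties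
open import Data.Bool using (Bool; T; not; _∧_)
open import Data.Bool.Properties using (T-∧; T?)
open import Data.Unit using (tt)
open import Data.Nat as ℕ using (ℕ; zero; suc; _+_; _*_; _^_; _∸_; _≤_; _<_; z≤n; s≤s; _≤?_; _≟_)
import Data.Nat.Properties as ℕP
open import Data.Integer as ℤ using (ℤ; +_; ∣_∣; 0ℤ; 1ℤ)
import Data.Integer.Properties as ℤP
open import Data.Integer.Tactic.RingSolver using (solve-∀)
open import Data.Sign as Sign using (Sign)
open import Data.Fin as Fin using (Fin; fromℕ<)
open import Data.Vec as Vec using (Vec; []; _∷_; toList; zipWith; lookup)
open import Data.List as List using (List; []; _∷_; map; _++_; length; upTo; filter; cartesianProductWith)
import Data.List.Properties as ListP
open import Data.List.Relation.Unary.All as All using (All; []; _∷_)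
open import Data.List.Relation.Unary.Any using (here; there)
open import Data.List.Membership.Propositional using (_∈_)
open import Data.List.Membership.Propositional.Properties
open import Data.Product using (_×_; _,_; proj₁; proj₂)
open import Function using (_∘_; Equivalence)
open import Relation.Binary.PropositionalEquality
open import Relation.Nullary using (¬_; Dec; yes; no)
open import Relation.Nullary.Decidable using (⌊_⌋; toWitness; fromWitness)

open Equivalence using (to; from)
open CommSemigroupProperties ℕP.*-commutativeSemigroup using () renaming (interchange to *-interchange)
open CommSemigroupProperties ℤP.+-commutativeSemigroup using () renaming (interchange to ℤ-+-interchange)
open CommSemigroupProperties ℤP.*-commutativeSemigroup using () renaming (interchange to ℤ-*-interchange)

^-distribʳ-* : ∀ m k n → (m * k) ^ n ≡ m ^ n * k ^ n
^-distribʳ-* m k zero    = refl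
^-distribʳ-* m k (suc n) = trans (cong (m * k *_) (^-distribʳ-* m k n)) (*-interchange m k (m ^ n) (k ^ n))

sumℤ-++ : (xs ys : List ℤ) → sumℤ (xs ++ ys) ≡ sumℤ xs ℤ.+ sumℤ ys
sumℤ-++ []       ys = sym (ℤP.+-identityˡ (sumℤ ys))
sumℤ-++ (x ∷ xs) ys = trans (cong (ℤ._+_ x) (sumℤ-++ xs ys)) (sym (ℤP.+-assoc x (sumℤ xs) (sumℤ ys)))

module _ {A : Set} where

  sumℤ-map-*ˡ : (k : ℤ) (F : A → ℤ) (xs : List A) →
                sumℤ (map (λ x → k ℤ.* F x) xs) ≡ k ℤ.* sumℤ (map F xs)
  sumℤ-map-*ˡ k F []       = sym (ℤP.*-zeroʳ k)
  sumℤ-map-*ˡ k F (x ∷ xs) =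
    trans (cong (ℤ._+_ (k ℤ.* F x)) (sumℤ-map-*ˡ k F xs)) (sym (ℤP.*-distribˡ-+ k (F x) _))

  sumℤ-map-+ : (F G : A → ℤ) (xs : List A) →
               sumℤ (map (λ x → F x ℤ.+ G x) xs) ≡ sumℤ (map F xs) ℤ.+ sumℤ (map G xs)
  sumℤ-map-+ F G []       = refl
  sumℤ-map-+ F G (x ∷ xs) =
    trans (cong (ℤ._+_ (F x ℤ.+ G x)) (sumℤ-map-+ F G xs)) (ℤ-+-interchange (F x) (G x) _ _)

  sumℤ-map-0 : (xs : List A) → sumℤ (map (λ _ → 0ℤ) xs) ≡ 0ℤ
  sumℤ-map-0 []       = refl
  sumℤ-map-0 (x ∷ xs) = trans (ℤP.+-identityˡ _) (sumℤ-map-0 xs)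

  ∣sumℤ∣≤ : (F : A → ℤ) (B : ℕ) (xs : List A) → (∀ {x} → x ∈ xs → ∣ F x ∣ ≤ B) →
            ∣ sumℤ (map F xs) ∣ ≤ length xs * B
  ∣sumℤ∣≤ F B []       bound = z≤n
  ∣sumℤ∣≤ F B (x ∷ xs) bound = ℕP.≤-trans (ℤP.∣i+j∣≤∣i∣+∣j∣ (F x) _)
    (ℕP.+-mono-≤ (bound (here refl)) (∣sumℤ∣≤ F B xs (bound ∘ there)))

module _ {A B : Set} where

  sumℤ-swap : (F : A → B → ℤ) (xs : List A) (ys : List B) →
              sumℤ (map (λ x → sumℤ (map (F x) ys)) xs) ≡ sumℤ (map (λ y → sumℤ (map (λ x → F x y) xs)) ys)
  sumℤ-swap F []       ys = sym (sumℤ-map-0 ys)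
  sumℤ-swap F (x ∷ xs) ys = trans (cong (ℤ._+_ (sumℤ (map (F x) ys))) (sumℤ-swap F xs ys))
    (sym (sumℤ-map-+ (F x) (λ y → sumℤ (map (λ x → F x y) xs)) ys))

module _ {A B C : Set} (f : A → B → C) where

  length-cartesianProductWith : (xs : List A) (ys : List B) →
                                length (cartesianProductWith f xs ys) ≡ length xs * length ys
  length-cartesianProductWith []       ys = refl
  length-cartesianProductWith (x ∷ xs) ys = begin
    length (map (f x) ys ++ cartesianProductWith f xs ys)  ≡⟨ ListP.length-++ (map (f x) ys) ⟩
    length (map (f x) ys) + length (cartesianProductWith f xs ys)
      ≡⟨ cong₂ _+_ (ListP.length-map (f x) ys) (length-cartesianProductWith xs ys) ⟩
    length ys + length xs * length ys                        ∎
    where open ≡-Reasoning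

  sumℤ-cartesianProductWith : (F : C → ℤ) (G : A → ℤ) (H : B → ℤ) →
    (∀ x y → F (f x y) ≡ G x ℤ.* H y) → (xs : List A) (ys : List B) →
    sumℤ (map F (cartesianProductWith f xs ys)) ≡ sumℤ (map G xs) ℤ.* sumℤ (map H ys)
  sumℤ-cartesianProductWith F G H F-f []       ys = sym (ℤP.*-zeroˡ (sumℤ (map H ys)))
  sumℤ-cartesianProductWith F G H F-f (x ∷ xs) ys = begin
    sumℤ (map F (map (f x) ys ++ cartesianProductWith f xs ys))
      ≡⟨ cong sumℤ (ListP.map-++ F (map (f x) ys) _) ⟩
    sumℤ (map F (map (f x) ys) ++ map F (cartesianProductWith f xs ys))
      ≡⟨ sumℤ-++ (map F (map (f x) ys)) _ ⟩
    sumℤ (map F (map (f x) ys)) ℤ.+ sumℤ (map F (cartesianProductWith f xs ys))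
      ≡⟨ cong₂ ℤ._+_ row (sumℤ-cartesianProductWith F G H F-f xs ys) ⟩
    G x ℤ.* ΣH ℤ.+ sumℤ (map G xs) ℤ.* ΣH
      ≡⟨ ℤP.*-distribʳ-+ ΣH (G x) (sumℤ (map G xs)) ⟨
    (G x ℤ.+ sumℤ (map G xs)) ℤ.* ΣH ∎
    where
    open ≡-Reasoning
    ΣH = sumℤ (map H ys)
    row : sumℤ (map F (map (f x) ys)) ≡ G x ℤ.* ΣH
    row = trans (cong sumℤ (trans (sym (ListP.map-∘ ys)) (ListP.map-cong (F-f x) ys)))
                (sumℤ-map-*ˡ (G x) H ys)

maxList-ub : {x : ℕ} {xs : List ℕ} → x ∈ xs → x ≤ maxList xs
maxList-ub {xs = y ∷ ys} (here refl) = ℕP.m≤m⊔n y _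
maxList-ub {xs = y ∷ ys} (there x∈)  = ℕP.≤-trans (maxList-ub x∈) (ℕP.m≤n⊔m y _)

maxList-lub : {b : ℕ} (xs : List ℕ) → (∀ {x} → x ∈ xs → x ≤ b) → maxList xs ≤ b
maxList-lub []       ub = z≤n
maxList-lub (x ∷ xs) ub = ℕP.⊔-lub (ub (here refl)) (maxList-lub xs (ub ∘ there))

∈-vecs : (n : ℕ) {k : ℕ} (v : Vec ℕ k) → All (_< n) (toList v) → v ∈ vecs n k
∈-vecs n []      []         = here refl
∈-vecs n (x ∷ v) (x<n ∷ v<n) =
  ∈-concat⁺′ (∈-map⁺ (x ∷_) (∈-vecs n v v<n)) (∈-map⁺ (λ d → map (d ∷_) (vecs n _)) (∈-upTo⁺ x<n))

∈-tuples : {A : Set} (xs : List A) {k : ℕ} (v : Vec A k) → All (_∈ xs) (toList v) → v ∈ tuples xs k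
∈-tuples xs []      []         = here refl
∈-tuples xs (x ∷ v) (x∈ ∷ v∈) =
  ∈-concat⁺′ (∈-map⁺ (x ∷_) (∈-tuples xs v v∈)) (∈-map⁺ (λ y → map (y ∷_) (tuples xs _)) x∈)

module _ {A : Set} (p : A → Bool) where

  All⇒allB : {xs : List A} → All (T ∘ p) xs → T (allB p xs)
  All⇒allB []         = tt
  All⇒allB (px ∷ pxs) = from T-∧ (px , All⇒allB pxs)

  allB⇒All : (xs : List A) → T (allB p xs) → All (T ∘ p) xs
  allB⇒All []       _   = []
  allB⇒All (x ∷ xs) all = let px , pxs = to T-∧ all in px ∷ allB⇒All xs pxs

strictInc-∷⁻ : (d : ℕ) (ds : List ℕ) → T (strictInc (d ∷ ds)) → All (d <_) ds × T (strictInc ds)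
strictInc-∷⁻ d []       _   = [] , tt
strictInc-∷⁻ d (y ∷ ys) inc =
  let d<y , inc′ = to (T-∧ {⌊ d ℕ.<? y ⌋}) inc in
  (toWitness d<y ∷ All.map (ℕP.<-trans (toWitness d<y)) (proj₁ (strictInc-∷⁻ y ys inc′))) , inc′

nonDec-∷⁺ : {d : ℕ} {xs : List ℕ} → All (d ≤_) xs → T (nonDec xs) → T (nonDec (d ∷ xs))
nonDec-∷⁺ []         _  = tt
nonDec-∷⁺ (d≤x ∷ _) nd = from T-∧ (fromWitness d≤x , nd)

module _ {N M : ℕ} where

  fits⁻ : (ds : List ℕ) → T (fits N M ds) → 1 ≤ M × All (λ d → M + d ≤ N) ds
  fits⁻ ds fit = let 1≤M , ds-fit = to (T-∧ {⌊ 1 ≤? M ⌋}) fit in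
    toWitness 1≤M , All.map toWitness (allB⇒All _ ds ds-fit)

  fits⁺ : {ds : List ℕ} → 1 ≤ M → All (λ d → M + d ≤ N) ds → T (fits N M ds)
  fits⁺ 1≤M ds-fit = from T-∧ (fromWitness 1≤M , All⇒allB _ (All.map fromWitness ds-fit))

  fits⇒< : (ds : List ℕ) → T (fits N M ds) → All (_< N) ds
  fits⇒< ds fit = let 1≤M , ds-fit = fits⁻ ds fit in
    All.map (λ {d} → ℕP.<-≤-trans (ℕP.+-monoˡ-≤ d 1≤M)) ds-fit

  fits-⊆ : {ds es : List ℕ} → All (_∈ ds) es → T (fits N M ds) → T (fits N M es)
  fits-⊆ {ds} es⊆ds fit = let 1≤M , ds-fit = fits⁻ ds fit in
    fits⁺ 1≤M (All.map (All.lookup ds-fit) es⊆ds)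

not-both : {P Q : Set} (p? : Dec P) (q? : Dec Q) → ¬ (P × Q) → T (not (⌊ p? ⌋ ∧ ⌊ q? ⌋))
not-both (yes p) (yes q) ¬pq = ¬pq (p , q)
not-both (yes p) (no _)  _   = tt
not-both (no _)  _       _   = tt

distinctShifts-∷⁺ : {N : ℕ} {E : Seq N} {d : ℕ} {ps : List (Seq N × ℕ)} →
  All (λ p → ¬ (E ≡ proj₁ p × d ≡ proj₂ p)) ps → T (distinctShifts ps) → T (distinctShifts ((E , d) ∷ ps))
distinctShifts-∷⁺ {E = E} {d} fresh ds =
  from T-∧ (All⇒allB _ (All.map (λ {p} → not-both (seq? E (proj₁ p)) (d ≟ proj₂ p)) fresh) , ds)

All-zip-proj₂ : {A B : Set} {P : B → Set} {m : ℕ} (Es : Vec A m) (Ds : Vec B m) →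
                All P (toList Ds) → All (P ∘ proj₂) (toList (zipWith _,_ Es Ds))
All-zip-proj₂ []       []       []         = []
All-zip-proj₂ (E ∷ Es) (D ∷ Ds) (pD ∷ pDs) = pD ∷ All-zip-proj₂ Es Ds pDs

module _ {N : ℕ} where

  C-lub : {b : ℕ} (ℓ : ℕ) (e : Seq N) →
    (∀ M (D : Vec ℕ ℓ) → M ≤ N → T (corrAdm N M D) → ∣ corrSum e M D ∣ ≤ b) → C ℓ e ≤ b
  C-lub {b} ℓ e bound = maxList-lub _ bounded
    where
    row : ℕ → List ℕ
    row M = map (λ D → ∣ corrSum e M D ∣) (filter (λ D → T? (corrAdm N M D)) (vecs N ℓ))
    bounded : ∀ {x} → x ∈ List.concat (map row (upTo (suc N))) → x ≤ b
    bounded x∈ with _ , x∈row , row∈ ← ∈-concat⁻′ (map row (upTo (suc N))) x∈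
               with M , M∈ , refl ← ∈-map⁻ row row∈
               with D , D∈ , refl ← ∈-map⁻ _ x∈row
      = bound M D (ℕP.≤-pred (∈-upTo⁻ M∈))
                  (proj₂ (∈-filter⁻ (λ D → T? (corrAdm N M D)) {xs = vecs N ℓ} D∈))

  crossSum≤Ctilde : {m M : ℕ} (Es : Vec (Seq N) m) (D : Vec ℕ m) → M ≤ N → T (crossAdm N Es M D) →
                    ∣ crossSum Es M D ∣ ≤ Ctilde Es
  crossSum≤Ctilde {m} {M} Es D M≤N adm =
    maxList-ub (∈-concat⁺′ (∈-map⁺ (λ D → ∣ crossSum Es M D ∣) D∈row) row∈)
    where
    row : ℕ → List ℕ
    row M = map (λ D → ∣ crossSum Es M D ∣) (filter (λ D → T? (crossAdm N Es M D)) (vecs N m))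
    row∈ : row M ∈ map row (upTo (suc N))
    row∈ = ∈-map⁺ row (∈-upTo⁺ (s≤s M≤N))
    fit : T (fits N M (toList D))
    fit = proj₁ (to (T-∧ {fits N M (toList D)}) (proj₂ (to (T-∧ {nonDec (toList D)}) adm)))
    D∈row = ∈-filter⁺ (λ D → T? (crossAdm N Es M D)) (∈-vecs N D (fits⇒< (toList D) fit)) adm

  Ctilde≤Φ : {m : ℕ} {𝓕 : List (Seq N)} {Es : Vec (Seq N) m} → All (_∈ 𝓕) (toList Es) → Ctilde Es ≤ Φ m 𝓕
  Ctilde≤Φ {𝓕 = 𝓕} {Es} Es∈ = maxList-ub (∈-map⁺ Ctilde (∈-tuples 𝓕 Es Es∈))

  Φ≤maxΦ : {ℓ m : ℕ} {𝓕 : List (Seq N)} → ℓ ≤ m → m ≤ ℓ + ℓ → Φ m 𝓕 ≤ maxΦ ℓ 𝓕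
  Φ≤maxΦ {ℓ} {m} {𝓕} ℓ≤m m≤2ℓ = subst (λ k → Φ k 𝓕 ≤ maxΦ ℓ 𝓕) (ℕP.m+[n∸m]≡n ℓ≤m)
    (maxList-ub (∈-map⁺ (λ j → Φ (ℓ + j) 𝓕) (∈-upTo⁺ (s≤s m∸ℓ≤ℓ))))
    where m∸ℓ≤ℓ = subst (m ∸ ℓ ≤_) (ℕP.m+n∸n≡m ℓ ℓ) (ℕP.∸-monoˡ-≤ ℓ m≤2ℓ)

-- A signed product ± E⁽¹⁾_{n+d₁} ⋯ E⁽ᵐ⁾_{n+dₘ}, as a function of n.
record Monomial (N : ℕ) : Set where
  constructor monomial
  field
    sign   : Sign
    order  : ℕ
    seqs   : Vec (Seq N) order
    shifts : Vec ℕ order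

open Monomial

module _ {N : ℕ} where

  crossTerm : {m : ℕ} → Vec (Seq N) m → Vec ℕ m → ℕ → ℤ
  crossTerm Es Ds n = prodℤ (toList (zipWith (λ E d → at E (suc n + d)) Es Ds))

  crossTerm-++ : {m k : ℕ} (Es : Vec (Seq N) m) (Ds : Vec ℕ m) (Fs : Vec (Seq N) k) (Gs : Vec ℕ k) (n : ℕ) →
                 crossTerm (Es Vec.++ Fs) (Ds Vec.++ Gs) n ≡ crossTerm Es Ds n ℤ.* crossTerm Fs Gs n
  crossTerm-++ []       []       Fs Gs n = sym (ℤP.*-identityˡ (crossTerm Fs Gs n))
  crossTerm-++ (E ∷ Es) (d ∷ Ds) Fs Gs n =
    trans (cong (at E (suc n + d) ℤ.*_) (crossTerm-++ Es Ds Fs Gs n))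
          (sym (ℤP.*-assoc (at E (suc n + d)) (crossTerm Es Ds n) (crossTerm Fs Gs n)))

  value : ℕ → Monomial N → ℤ
  value n t = val (sign t) ℤ.* crossTerm (seqs t) (shifts t) n

  -- Defined through projections, so that a concrete left factor computes against an unknown right one.
  _⊗_ : Monomial N → Monomial N → Monomial N
  a ⊗ b = monomial (sign a Sign.* sign b) (order a + order b) (seqs a Vec.++ seqs b) (shifts a Vec.++ shifts b)

val-* : (s t : Sign) → val (s Sign.* t) ≡ val s ℤ.* val t
val-* Sign.+ Sign.+ = refl
val-* Sign.+ Sign.- = refl
val-* Sign.- Sign.+ = refl
val-* Sign.- Sign.- = refl

∣val*∣ : (s : Sign) (x : ℤ) → ∣ val s ℤ.* x ∣ ≡ ∣ x ∣
∣val*∣ Sign.+ x = cong ∣_∣ (ℤP.*-identityˡ x)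
∣val*∣ Sign.- x = trans (cong ∣_∣ (ℤP.-1*i≡-i x)) (ℤP.∣-i∣≡∣i∣ x)

value-⊗ : {N : ℕ} (n : ℕ) (a b : Monomial N) → value n (a ⊗ b) ≡ value n a ℤ.* value n b
value-⊗ n a b = trans
  (cong₂ ℤ._*_ (val-* (sign a) (sign b)) (crossTerm-++ (seqs a) (shifts a) (seqs b) (shifts b) n))
  (ℤ-*-interchange (val (sign a)) (val (sign b)) _ _)

record Admissible {N ℓ : ℕ} (𝓕 : List (Seq N)) (D : Vec ℕ ℓ) (t : Monomial N) : Set where
  field
    seqs∈𝓕        : All (_∈ 𝓕) (toList (seqs t))
    shifts⊆D      : All (_∈ toList D) (toList (shifts t))
    ℓ≤order       : ℓ ≤ order t
    order≤2ℓ      : order t ≤ ℓ + ℓ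
    shifts-nonDec : T (nonDec (toList (shifts t)))
    distinct      : T (distinctShifts (toList (zipWith _,_ (seqs t) (shifts t))))

module _ {N ℓ : ℕ} {𝓕 : List (Seq N)} {D : Vec ℕ ℓ} where
  open Admissible

  Admissible-crossSum≤maxΦ : {M : ℕ} {t : Monomial N} → Admissible 𝓕 D t → M ≤ N → T (fits N M (toList D)) →
                             ∣ crossSum (seqs t) M (shifts t) ∣ ≤ maxΦ ℓ 𝓕
  Admissible-crossSum≤maxΦ {t = t} adm M≤N fit =
    ℕP.≤-trans (crossSum≤Ctilde (seqs t) (shifts t) M≤N crossAdm-t)
    (ℕP.≤-trans (Ctilde≤Φ (seqs∈𝓕 adm)) (Φ≤maxΦ {ℓ = ℓ} (ℓ≤order adm) (order≤2ℓ adm)))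
    where
    crossAdm-t = from T-∧ (shifts-nonDec adm , from T-∧ (fits-⊆ (shifts⊆D adm) fit , distinct adm))

  module _ {d : ℕ} (d<D : All (d <_) (toList D)) (s : Sign) {E : Seq N} (E∈ : E ∈ 𝓕) {t : Monomial N}
           (adm : Admissible 𝓕 D t) where

    private
      d<shifts : All (d <_) (toList (shifts t))
      d<shifts = All.map (All.lookup d<D) (shifts⊆D adm)

      fresh : (F : Seq N) → All (λ p → ¬ (F ≡ proj₁ p × d ≡ proj₂ p)) (toList (zipWith _,_ (seqs t) (shifts t)))
      fresh F = All.map (λ d<p (_ , d≡p) → ℕP.<-irrefl d≡p d<p) (All-zip-proj₂ (seqs t) (shifts t) d<shifts)

      d≤shifts : All (d ≤_) (toList (shifts t))
      d≤shifts = All.map ℕP.<⇒≤ d<shifts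

    Admissible-∷ : Admissible 𝓕 (d ∷ D) (monomial s 1 (E ∷ []) (d ∷ []) ⊗ t)
    Admissible-∷ = record
      { seqs∈𝓕        = E∈ ∷ seqs∈𝓕 adm
      ; shifts⊆D      = here refl ∷ All.map there (shifts⊆D adm)
      ; ℓ≤order       = s≤s (ℓ≤order adm)
      ; order≤2ℓ      = s≤s (ℕP.≤-trans (order≤2ℓ adm) (ℕP.+-monoʳ-≤ ℓ (ℕP.n≤1+n ℓ)))
      ; shifts-nonDec = nonDec-∷⁺ d≤shifts (shifts-nonDec adm)
      ; distinct      = distinctShifts-∷⁺ (fresh E) (distinct adm)
      }

    Admissible-∷∷ : {H : Seq N} → H ∈ 𝓕 → E ≢ H →
                    Admissible 𝓕 (d ∷ D) (monomial s 2 (E ∷ H ∷ []) (d ∷ d ∷ []) ⊗ t)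
    Admissible-∷∷ {H} H∈ E≢H = record
      { seqs∈𝓕        = E∈ ∷ H∈ ∷ seqs∈𝓕 adm
      ; shifts⊆D      = here refl ∷ here refl ∷ All.map there (shifts⊆D adm)
      ; ℓ≤order       = s≤s (ℕP.m≤n⇒m≤1+n (ℓ≤order adm))
      ; order≤2ℓ      = s≤s (ℕP.≤-trans (s≤s (order≤2ℓ adm)) (ℕP.≤-reflexive (sym (ℕP.+-suc ℓ ℓ))))
      ; shifts-nonDec = nonDec-∷⁺ (ℕP.≤-refl ∷ d≤shifts) (nonDec-∷⁺ d≤shifts (shifts-nonDec adm))
      ; distinct      = distinctShifts-∷⁺ ((λ (E≡H , _) → E≢H E≡H) ∷ fresh E)
                                          (distinctShifts-∷⁺ (fresh H) (distinct adm))
      }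

select : Sign → Sign → Sign → Sign
select Sign.+ a b = a
select Sign.- a b = b

lookup-mix : {N : ℕ} (f g h : Seq N) (i : Fin N) →
             lookup (mix f g h) i ≡ select (lookup h i) (lookup f i) (lookup g i)
lookup-mix (x ∷ f) (y ∷ g) (Sign.+ ∷ h) Fin.zero    = refl
lookup-mix (x ∷ f) (y ∷ g) (Sign.- ∷ h) Fin.zero    = refl
lookup-mix (x ∷ f) (y ∷ g) (z ∷ h)      (Fin.suc i) = lookup-mix f g h i

2*val-select : (a b c : Sign) →
               + 2 ℤ.* val (select c a b) ≡ val a ℤ.* (1ℤ ℤ.+ val c) ℤ.+ val b ℤ.* (1ℤ ℤ.- val c)
2*val-select Sign.+ Sign.+ Sign.+ = refl
2*val-select Sign.+ Sign.+ Sign.- = refl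
2*val-select Sign.+ Sign.- Sign.+ = refl
2*val-select Sign.+ Sign.- Sign.- = refl
2*val-select Sign.- Sign.+ Sign.+ = refl
2*val-select Sign.- Sign.+ Sign.- = refl
2*val-select Sign.- Sign.- Sign.+ = refl
2*val-select Sign.- Sign.- Sign.- = refl

module Mixing {N : ℕ} (f g h : Seq N) where

  2*at-mix : (k : ℕ) →
             + 2 ℤ.* at (mix f g h) k ≡ at f k ℤ.* (1ℤ ℤ.+ at h k) ℤ.+ at g k ℤ.* (1ℤ ℤ.- at h k)
  2*at-mix zero    = refl
  2*at-mix (suc j) with j ℕ.<? N
  ... | no _    = refl
  ... | yes j<N = trans (cong (ℤ._*_ (+ 2) ∘ val) (lookup-mix f g h i))
                        (2*val-select (lookup f i) (lookup g i) (lookup h i))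
    where i = fromℕ< j<N

  mixFactor : ℕ → List (Monomial N)
  mixFactor d = monomial Sign.+ 1 (f ∷ []) (d ∷ [])
              ∷ monomial Sign.+ 2 (f ∷ h ∷ []) (d ∷ d ∷ [])
              ∷ monomial Sign.+ 1 (g ∷ []) (d ∷ [])
              ∷ monomial Sign.- 2 (g ∷ h ∷ []) (d ∷ d ∷ [])
              ∷ []

  mixFactor-value : (n d : ℕ) → sumℤ (map (value n) (mixFactor d)) ≡ + 2 ℤ.* at (mix f g h) (suc n + d)
  mixFactor-value n d = trans (multiplyOut (at f k) (at h k) (at g k)) (sym (2*at-mix k))
    where
    k = suc n + d
    multiplyOut : ∀ a b c →
      1ℤ ℤ.* (a ℤ.* 1ℤ) ℤ.+ (1ℤ ℤ.* (a ℤ.* (b ℤ.* 1ℤ)) ℤ.+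
        (1ℤ ℤ.* (c ℤ.* 1ℤ) ℤ.+ (ℤ.-1ℤ ℤ.* (c ℤ.* (b ℤ.* 1ℤ)) ℤ.+ 0ℤ)))
      ≡ a ℤ.* (1ℤ ℤ.+ b) ℤ.+ c ℤ.* (1ℤ ℤ.- b)
    multiplyOut = solve-∀

  expansion : {ℓ : ℕ} → Vec ℕ ℓ → List (Monomial N)
  expansion []      = monomial Sign.+ 0 [] [] ∷ []
  expansion (d ∷ D) = cartesianProductWith _⊗_ (mixFactor d) (expansion D)

  length-expansion : {ℓ : ℕ} (D : Vec ℕ ℓ) → length (expansion D) ≡ 4 ^ ℓ
  length-expansion []      = refl
  length-expansion (d ∷ D) =
    trans (length-cartesianProductWith _⊗_ (mixFactor d) (expansion D)) (cong (4 *_) (length-expansion D))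

  expansion-value : {ℓ : ℕ} (D : Vec ℕ ℓ) (n : ℕ) →
    + (2 ^ ℓ) ℤ.* prodℤ (map (λ d → at (mix f g h) (suc n + d)) (toList D))
      ≡ sumℤ (map (value n) (expansion D))
  expansion-value []      n = refl
  expansion-value {suc ℓ} (d ∷ D) n = begin
    + (2 * 2 ^ ℓ) ℤ.* (x ℤ.* P)          ≡⟨ cong (ℤ._* (x ℤ.* P)) (ℤP.pos-* 2 (2 ^ ℓ)) ⟩
    (+ 2 ℤ.* + (2 ^ ℓ)) ℤ.* (x ℤ.* P)    ≡⟨ ℤ-*-interchange (+ 2) (+ (2 ^ ℓ)) x P ⟩
    (+ 2 ℤ.* x) ℤ.* (+ (2 ^ ℓ) ℤ.* P)    ≡⟨ cong₂ ℤ._*_ (sym (mixFactor-value n d)) (expansion-value D n) ⟩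
    sumℤ (map (value n) (mixFactor d)) ℤ.* sumℤ (map (value n) (expansion D))
      ≡⟨ sumℤ-cartesianProductWith _⊗_ (value n) (value n) (value n) (value-⊗ n) (mixFactor d) (expansion D) ⟨
    sumℤ (map (value n) (expansion (d ∷ D))) ∎
    where
    open ≡-Reasoning
    x = at (mix f g h) (suc n + d)
    P = prodℤ (map (λ d → at (mix f g h) (suc n + d)) (toList D))

  corrSum-expansion : {ℓ : ℕ} (M : ℕ) (D : Vec ℕ ℓ) →
    + (2 ^ ℓ) ℤ.* corrSum (mix f g h) M D
      ≡ sumℤ (map (λ t → val (sign t) ℤ.* crossSum (seqs t) M (shifts t)) (expansion D))
  corrSum-expansion {ℓ} M D = begin
    + (2 ^ ℓ) ℤ.* corrSum (mix f g h) M D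
      ≡⟨ sumℤ-map-*ˡ (+ (2 ^ ℓ)) (λ n → prodℤ (map (λ d → at (mix f g h) (suc n + d)) (toList D))) (upTo M) ⟨
    sumℤ (map (λ n → + (2 ^ ℓ) ℤ.* prodℤ (map (λ d → at (mix f g h) (suc n + d)) (toList D))) (upTo M))
      ≡⟨ cong sumℤ (ListP.map-cong (expansion-value D) (upTo M)) ⟩
    sumℤ (map (λ n → sumℤ (map (value n) (expansion D))) (upTo M))
      ≡⟨ sumℤ-swap value (upTo M) (expansion D) ⟩
    sumℤ (map (λ t → sumℤ (map (λ n → value n t) (upTo M))) (expansion D))
      ≡⟨ cong sumℤ (ListP.map-cong (λ t → sumℤ-map-*ˡ (val (sign t)) (crossTerm (seqs t) (shifts t)) (upTo M))
                                    (expansion D)) ⟩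
    sumℤ (map (λ t → val (sign t) ℤ.* crossSum (seqs t) M (shifts t)) (expansion D)) ∎
    where open ≡-Reasoning

  corrSum-bound : {ℓ : ℕ} (M B : ℕ) (D : Vec ℕ ℓ) →
    (∀ {t} → t ∈ expansion D → ∣ crossSum (seqs t) M (shifts t) ∣ ≤ B) →
    ∣ corrSum (mix f g h) M D ∣ ≤ 2 ^ ℓ * B
  corrSum-bound {ℓ} M B D bound = ℕP.*-cancelˡ-≤ (2 ^ ℓ) {{ℕP.m^n≢0 2 ℓ}} (begin
    2 ^ ℓ * ∣ corrSum (mix f g h) M D ∣         ≡⟨ ℤP.abs-* (+ (2 ^ ℓ)) (corrSum (mix f g h) M D) ⟨
    ∣ + (2 ^ ℓ) ℤ.* corrSum (mix f g h) M D ∣   ≡⟨ cong ∣_∣ (corrSum-expansion M D) ⟩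
    ∣ sumℤ (map term (expansion D)) ∣           ≤⟨ ∣sumℤ∣≤ term B (expansion D) term-bound ⟩
    length (expansion D) * B                    ≡⟨ cong (_* B) (length-expansion D) ⟩
    4 ^ ℓ * B                                   ≡⟨ cong (_* B) (^-distribʳ-* 2 2 ℓ) ⟩
    2 ^ ℓ * 2 ^ ℓ * B                           ≡⟨ ℕP.*-assoc (2 ^ ℓ) (2 ^ ℓ) B ⟩
    2 ^ ℓ * (2 ^ ℓ * B)                         ∎)
    where
    open ℕP.≤-Reasoning
    term : Monomial N → ℤ
    term t = val (sign t) ℤ.* crossSum (seqs t) M (shifts t)
    term-bound : ∀ {t} → t ∈ expansion D → ∣ term t ∣ ≤ B
    term-bound {t} t∈ = subst (_≤ B) (sym (∣val*∣ (sign t) _)) (bound t∈)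

  module _ {𝓕 : List (Seq N)} (f∈ : f ∈ 𝓕) (g∈ : g ∈ 𝓕) (h∈ : h ∈ 𝓕) (f≢h : f ≢ h) (g≢h : g ≢ h) where

    expansion-admissible : {ℓ : ℕ} (D : Vec ℕ ℓ) → T (strictInc (toList D)) →
                           ∀ {t} → t ∈ expansion D → Admissible 𝓕 D t
    expansion-admissible [] _ (here refl) = record
      { seqs∈𝓕 = [] ; shifts⊆D = [] ; ℓ≤order = z≤n ; order≤2ℓ = z≤n ; shifts-nonDec = tt ; distinct = tt }
    expansion-admissible (d ∷ D) inc t∈
      with d<D , incD ← strictInc-∷⁻ d (toList D) inc
      with a , b , a∈ , b∈ , refl ← ∈-cartesianProductWith⁻ _⊗_ (mixFactor d) (expansion D) t∈
      with adm ← expansion-admissible D incD b∈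
      with a∈
    ... | here refl                         = Admissible-∷ d<D Sign.+ f∈ adm
    ... | there (here refl)                 = Admissible-∷∷ d<D Sign.+ f∈ adm h∈ f≢h
    ... | there (there (here refl))         = Admissible-∷ d<D Sign.+ g∈ adm
    ... | there (there (there (here refl))) = Admissible-∷∷ d<D Sign.- g∈ adm h∈ g≢h

theorem3 : (N ℓ : ℕ) → 1 ≤ N → 1 ≤ ℓ → (𝓕 : List (Seq N))
    → (f g h : Seq N) → f ∈ 𝓕 → g ∈ 𝓕 → h ∈ 𝓕 → f ≢ g → f ≢ h → g ≢ h
    → C ℓ (mix f g h) ≤ 2 ^ ℓ * maxΦ ℓ 𝓕
theorem3 N ℓ _ _ 𝓕 f g h f∈ g∈ h∈ _ f≢h g≢h = C-lub ℓ (mix f g h) λ M D M≤N adm →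
  let inc , fit = to (T-∧ {strictInc (toList D)}) adm in
  corrSum-bound M (maxΦ ℓ 𝓕) D λ t∈ →
    Admissible-crossSum≤maxΦ (expansion-admissible f∈ g∈ h∈ f≢h g≢h D inc t∈) M≤N fit
  where open Mixing f g h
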